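{- A simple directed graph $G$ is a C1P-digraph if and only if $G$ admits an LR-order in which, for every vertex $v$, the successors of $v$ occupy consecutive positions.
   Context: A simple directed graph has no loops and no multiple arcs. A C1P-digraph is a simple directed graph whose adjacency matrix has the Consecutive Ones Property for rows. This means the columns can be permuted so that in every row the entries equal to 1 are consecutive. An LR-order of a digraph $G=(V,E)$ is a linear order $\prec$ on $V$ such that, for every vertex $v$, the successors of $v$ are either all before $v$ or all after $v$. -}

module Defs where

open import Data.Nat using (ℕ)
open import Data.Fin using (Fin; _≤_; _<_)
open import Data.Bool using (Bool; true)
open import Data.Sum using (_⊎_)
open import Data.Product using (∃)
open import Data.Empty using (⊥)
open import Data.Fin.Permutation using (Permutation′; _⟨$⟩ʳ_; _⟨$⟩ˡ_)
open import Relation.Binary.PropositionalEquality using (_≡_)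
open import Relation.Nullary using (¬_)

-- Being a relation, there are
-- no multiple arcs; simplicity additionally requires no loops.
Digraph : ℕ → Set
Digraph n = Fin n → Fin n → Bool

Arc : ∀ {n} → Digraph n → Fin n → Fin n → Set
Arc A u v = A u v ≡ true

Simple : ∀ {n} → Digraph n → Set
Simple A = ∀ v → ¬ Arc A v v

-- A set S of vertices (a predicate) is consecutive w.r.t. the linear
-- order given by the bijection π (π ⟨$⟩ʳ i = vertex in position i):
-- whenever positions i ≤ j ≤ k with the vertices at i and k in S, the
-- vertex at j is in S.
ConsecutiveIn : ∀ {n} → Permutation′ n → (Fin n → Set) → Set
ConsecutiveIn {n} π S =
  ∀ (i j k : Fin n) → i ≤ j → j ≤ k →
    S (π ⟨$⟩ʳ i) → S (π ⟨$⟩ʳ k) → S (π ⟨$⟩ʳ j)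

-- Consecutive ones property for rows: some column permutation π
-- (π ⟨$⟩ʳ i = original column placed at position i) makes the 1-entries
-- of every row consecutive.
C1P : ∀ {n} → Digraph n → Set
C1P {n} A = ∃ λ (π : Permutation′ n) → ∀ u → ConsecutiveIn π (Arc A u)

-- Position-based linear order: π ⟨$⟩ˡ v is the position of vertex v.
_≺[_]_ : ∀ {n} → Fin n → Permutation′ n → Fin n → Set
u ≺[ π ] v = (π ⟨$⟩ˡ u) < (π ⟨$⟩ˡ v)

IsLROrder : ∀ {n} → Digraph n → Permutation′ n → Set
IsLROrder A π = ∀ v →
  (∀ w → Arc A v w → w ≺[ π ] v) ⊎ (∀ w → Arc A v w → v ≺[ π ] w)

SuccessorsConsecutive : ∀ {n} → Digraph n → Permutation′ n → Set
SuccessorsConsecutive A π = ∀ v → ConsecutiveIn π (Arc A v)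

module Submission where

-- A C1P-digraph is one whose rows can be made consecutive by a single
-- column permutation π; reading π as a linear order of the vertices,
-- this says exactly that the successor set of every vertex is
-- consecutive.  So the backward direction of the theorem is immediate,
-- and the forward direction only needs that such an order is
-- automatically an LR-order.
--
-- That rests on one general fact about linear orders: a consecutive
-- (decidable) set of vertices that misses a vertex v lies entirely on
-- one side of v, since elements on both sides would force v into the
-- set.  In a simple digraph v is not its own successor, so applying
-- the fact to the successor set of v gives the LR-condition at v.

open import Defs
open import Data.Nat using (ℕ)
open import Data.Nat.Properties using (<⇒≤)
open import Data.Bool using (true; _≟_)
open import Data.Fin using (Fin; _≤_; _<?_)
open import Data.Fin.Properties using (any?; <-cmp)
open import Data.Fin.Permutation using (Permutation′; _⟨$⟩ʳ_; _⟨$⟩ˡ_; inverseʳ)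
open import Data.Product using (_×_; ∃; _,_)
open import Data.Sum using (_⊎_; inj₁; inj₂)
open import Data.Empty using (⊥-elim)
open import Function.Bundles using (_⇔_; mk⇔)
open import Relation.Binary.Definitions using (tri<; tri≈; tri>)
open import Relation.Binary.PropositionalEquality using (_≡_; cong; subst; sym; module ≡-Reasoning)
open import Relation.Nullary using (yes; no; ¬_; _×-dec_)
open import Relation.Unary using (Pred; Decidable)
open import Level using (0ℓ)

module _ {n : ℕ} (π : Permutation′ n) where

  pos : Fin n → Fin n
  pos v = π ⟨$⟩ˡ v

  pos-injective : ∀ {u v} → pos u ≡ pos v → u ≡ v
  pos-injective {u} {v} eq = begin
      u                 ≡⟨ sym (inverseʳ π) ⟩
      π ⟨$⟩ʳ pos u      ≡⟨ cong (π ⟨$⟩ʳ_) eq ⟩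
      π ⟨$⟩ʳ pos v      ≡⟨ inverseʳ π ⟩
      v                 ∎
    where open ≡-Reasoning

  between-members : ∀ {S : Pred (Fin n) 0ℓ} → ConsecutiveIn π S →
    ∀ {u v w} → pos u ≤ pos v → pos v ≤ pos w → S u → S w → S v
  between-members {S} cons {u} {v} {w} u≤v v≤w Su Sw =
    subst S (inverseʳ π)
      (cons (pos u) (pos v) (pos w) u≤v v≤w
        (subst S (sym (inverseʳ π)) Su)
        (subst S (sym (inverseʳ π)) Sw))

  -- A consecutive decidable set missing v lies entirely before v or
  -- entirely after v: if some member precedes v, a member after v
  -- would put v itself into the set.
  one-side-of : ∀ {S : Pred (Fin n) 0ℓ} → Decidable S → ConsecutiveIn π S →
    ∀ {v} → ¬ S v → (∀ w → S w → w ≺[ π ] v) ⊎ (∀ w → S w → v ≺[ π ] w)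
  one-side-of {S} S? cons {v} v∉S
    with any? (λ w → S? w ×-dec (pos w <? pos v))
  ... | yes (u , Su , u≺v) = inj₁ before
    where
    before : ∀ w → S w → w ≺[ π ] v
    before w Sw with <-cmp (pos w) (pos v)
    ... | tri< w≺v _ _ = w≺v
    ... | tri≈ _ w≈v _ = ⊥-elim (v∉S (subst S (pos-injective w≈v) Sw))
    ... | tri> _ _ v≺w = ⊥-elim (v∉S (between-members cons (<⇒≤ u≺v) (<⇒≤ v≺w) Su Sw))
  ... | no none-before = inj₂ after
    where
    after : ∀ w → S w → v ≺[ π ] w
    after w Sw with <-cmp (pos w) (pos v)
    ... | tri< w≺v _ _ = ⊥-elim (none-before (w , Sw , w≺v))
    ... | tri≈ _ w≈v _ = ⊥-elim (v∉S (subst S (pos-injective w≈v) Sw))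
    ... | tri> _ _ v≺w = v≺w

consecutive⇒LR-order : ∀ {n} (A : Digraph n) → Simple A →
  ∀ π → SuccessorsConsecutive A π → IsLROrder A π
consecutive⇒LR-order A simple π cons v =
  one-side-of π (λ w → A v w ≟ true) (cons v) (simple v)

claim11 : ∀ (n : ℕ) (A : Digraph n) → Simple A →
    C1P A ⇔ (∃ λ π → IsLROrder A π × SuccessorsConsecutive A π)
claim11 n A simple = mk⇔ to from
  where
  to : C1P A → ∃ λ π → IsLROrder A π × SuccessorsConsecutive A π
  to (π , cons) = π , consecutive⇒LR-order A simple π cons , cons

  from : (∃ λ π → IsLROrder A π × SuccessorsConsecutive A π) → C1P A
  from (π , _ , cons) = π , cons
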